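{- For all nonnegative integers $n,k$ and every integer $s\ge1$, $$\binom{n}{k}_{[s]}=\sum_{i}\binom{n-i}{k}\binom{k}{i}_{s-1},$$ the sum running over all integers $i$.
   Context: For integers $n,k$ with $0\le k\le n$, $\binom{n}{k}_{[s]}$ is the number of lattice paths from $(0,0)$ to $(n,k)$ using steps from $\{(1,0),(1,1),(2,1),\ldots,(s,1)\}$; otherwise it is $0$. For integers $t\ge0$, $m\ge0$, the bi$^{t}$nomial coefficient $\binom{m}{i}_{t}$ is the coefficient of $x^i$ in $(1+x+\cdots+x^{t})^{m}$ (zero for $i<0$ or $i>tm$; for $t=0$ the polynomial is $1$). Binomial coefficients $\binom{a}{b}$ are $0$ unless $0\le b\le a$. -}

module Defs where

open import Data.Nat using (ℕ; zero; suc; _+_; _*_; _∸_)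
open import Data.Nat.Combinatorics using (_C_)
open import Data.List using (List; []; _∷_; upTo; map)
open import Data.Nat.ListAction using (sum)

-- Lattice paths from (0,0) to (n,k) with steps in
-- {(1,0),(1,1),(2,1),...,(s,1)}, counted by decomposing on the LAST step:
--   P(0,0) = 1,  P(0,k+1) = 0,
--   P(n+1,k) = P(n,k) + [k ≥ 1] Σ_{j=1}^{s} P(n+1-j, k-1)   (terms with j > n+1 are 0).
-- 'pathsF fuel' with fuel ≥ n computes P(n,k); fuel only ensures termination.
pathsF : ℕ → ℕ → ℕ → ℕ → ℕ
diagF  : ℕ → ℕ → ℕ → ℕ → ℕ → ℕ

pathsF fuel     s zero    zero    = 1
pathsF fuel     s zero    (suc k) = 0
pathsF zero     s (suc n) k       = 0
pathsF (suc f)  s (suc n) zero    = pathsF f s n zero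
pathsF (suc f)  s (suc n) (suc k) = pathsF f s n (suc k) + diagF f s s (suc n) k

diagF f s zero    m       k = 0
diagF f s (suc j) zero    k = 0
diagF f s (suc j) (suc m) k = pathsF f s m k + diagF f s j m k

paths : ℕ → ℕ → ℕ → ℕ
paths s n k = pathsF n s n k

binomS : ℕ → ℕ → ℕ → ℕ
binomS s n k = paths s n k

-- Polynomials with ℕ coefficients as coefficient lists (index = power of x).
Poly : Set
Poly = List ℕ

addP : Poly → Poly → Poly
addP []       q        = q
addP p        []       = p
addP (a ∷ p)  (b ∷ q)  = (a + b) ∷ addP p q

scaleP : ℕ → Poly → Poly
scaleP c = map (c *_)

mulP : Poly → Poly → Poly
mulP []      q = []
mulP (a ∷ p) q = addP (scaleP a q) (0 ∷ mulP p q)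

powP : Poly → ℕ → Poly
powP p zero    = 1 ∷ []
powP p (suc m) = mulP p (powP p m)

coeff : Poly → ℕ → ℕ
coeff []      i       = 0
coeff (a ∷ p) zero    = a
coeff (a ∷ p) (suc i) = coeff p i

ones : ℕ → Poly
ones zero    = 1 ∷ []
ones (suc t) = 1 ∷ ones t

bitnom : ℕ → ℕ → ℕ → ℕ
bitnom t m i = coeff (powP (ones t) m) i

sumTo : ℕ → (ℕ → ℕ) → ℕ
sumTo n f = sum (map f (upTo (suc n)))

{-# OPTIONS --safe #-}
-- Both sides satisfy the lattice-path recurrence
--   P(n+1, k+1) = P(n, k+1) + P(n, k) + P(n-1, k) + … + P(n+1-s, k)
-- with the same boundary values, and the recurrence determines P.
-- For the right-hand side, Pascal's rule on binom(n+1-i, k+1) produces the first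
-- term and leaves the convolution of binom(·, k) with the coefficients of
-- (1 + x + … + x^(s-1)) · (1 + x + … + x^(s-1))^k; multiplying by
-- 1 + x + … + x^(s-1) turns a convolution into the sum of its s shifts.
module Submission where

open import Defs
open import Data.Nat using (ℕ; zero; suc; _+_; _*_; _∸_; _≤_; z≤n; s≤s)
open import Data.Nat.Properties
open import Data.Nat.Combinatorics using (_C_; nCk+nC[k+1]≡[n+1]C[k+1])
open import Data.Nat.ListAction using (sum)
open import Data.Nat.ListAction.Properties using (sum-++)
open import Data.List using ([]; _∷_; _∷ʳ_; applyUpTo)
open import Data.List.Properties using (map-upTo; applyUpTo-∷ʳ)
open import Algebra.Properties.CommutativeSemigroup +-commutativeSemigroup using (interchange)
open import Function using (_∘_)
open import Relation.Binary.PropositionalEquality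
  using (_≡_; refl; sym; trans; cong; cong₂; module ≡-Reasoning)

open ≡-Reasoning

Σ≤ : ℕ → (ℕ → ℕ) → ℕ
Σ≤ n f = sum (applyUpTo f (suc n))

sumTo≡Σ≤ : ∀ n f → sumTo n f ≡ Σ≤ n f
sumTo≡Σ≤ n f = cong sum (map-upTo f (suc n))

Σ≤-cong : ∀ n {f g : ℕ → ℕ} → (∀ i → i ≤ n → f i ≡ g i) → Σ≤ n f ≡ Σ≤ n g
Σ≤-cong zero    f≗g = cong (_+ 0) (f≗g 0 z≤n)
Σ≤-cong (suc n) f≗g = cong₂ _+_ (f≗g 0 z≤n) (Σ≤-cong n (λ i i≤n → f≗g (suc i) (s≤s i≤n)))

Σ≤-zero : ∀ n (f : ℕ → ℕ) → (∀ i → f i ≡ 0) → Σ≤ n f ≡ 0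
Σ≤-zero zero    f f≗0 = cong (_+ 0) (f≗0 0)
Σ≤-zero (suc n) f f≗0 = cong₂ _+_ (f≗0 0) (Σ≤-zero n (f ∘ suc) (f≗0 ∘ suc))

Σ≤-distrib-+ : ∀ n (f g : ℕ → ℕ) → Σ≤ n (λ i → f i + g i) ≡ Σ≤ n f + Σ≤ n g
Σ≤-distrib-+ zero    f g = interchange (f 0) (g 0) 0 0
Σ≤-distrib-+ (suc n) f g = begin
  f 0 + g 0 + Σ≤ n (λ i → f (suc i) + g (suc i))
    ≡⟨ cong (f 0 + g 0 +_) (Σ≤-distrib-+ n (f ∘ suc) (g ∘ suc)) ⟩
  f 0 + g 0 + (Σ≤ n (f ∘ suc) + Σ≤ n (g ∘ suc))
    ≡⟨ interchange (f 0) (g 0) _ _ ⟩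
  Σ≤ (suc n) f + Σ≤ (suc n) g
    ∎

Σ≤-last : ∀ n (f : ℕ → ℕ) → Σ≤ (suc n) f ≡ Σ≤ n f + f (suc n)
Σ≤-last n f = begin
  sum (applyUpTo f (suc (suc n)))                   ≡⟨ cong sum (sym (applyUpTo-∷ʳ f (suc n))) ⟩
  sum (applyUpTo f (suc n) ∷ʳ f (suc n))            ≡⟨ sum-++ (applyUpTo f (suc n)) _ ⟩
  Σ≤ n f + (f (suc n) + 0)                          ≡⟨ cong (Σ≤ n f +_) (+-identityʳ _) ⟩
  Σ≤ n f + f (suc n)                                ∎

coeff-addP : ∀ p q i → coeff (addP p q) i ≡ coeff p i + coeff q i
coeff-addP []      q       i       = refl
coeff-addP (a ∷ p) []      i       = sym (+-identityʳ _)
coeff-addP (a ∷ p) (b ∷ q) zero    = refl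
coeff-addP (a ∷ p) (b ∷ q) (suc i) = coeff-addP p q i

coeff-scaleP : ∀ a p i → coeff (scaleP a p) i ≡ a * coeff p i
coeff-scaleP a []      i       = sym (*-zeroʳ a)
coeff-scaleP a (x ∷ p) zero    = refl
coeff-scaleP a (x ∷ p) (suc i) = coeff-scaleP a p i

coeff-mulP-∷ : ∀ a q p i → coeff (mulP (a ∷ q) p) i ≡ a * coeff p i + coeff (0 ∷ mulP q p) i
coeff-mulP-∷ a q p i = trans (coeff-addP (scaleP a p) _ i) (cong (_+ _) (coeff-scaleP a p i))

_⋆_ : (ℕ → ℕ) → (ℕ → ℕ) → ℕ → ℕ
(c ⋆ g) n = Σ≤ n (λ i → c (n ∸ i) * g i)

⋆-congʳ : ∀ c {g h : ℕ → ℕ} n → (∀ i → g i ≡ h i) → (c ⋆ g) n ≡ (c ⋆ h) n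
⋆-congʳ c n g≗h = Σ≤-cong n (λ i _ → cong (c (n ∸ i) *_) (g≗h i))

⋆-distribˡ-+ : ∀ c (g h : ℕ → ℕ) n → (c ⋆ (λ i → g i + h i)) n ≡ (c ⋆ g) n + (c ⋆ h) n
⋆-distribˡ-+ c g h n = trans (Σ≤-cong n (λ i _ → *-distribˡ-+ (c (n ∸ i)) (g i) (h i)))
                             (Σ≤-distrib-+ n (λ i → c (n ∸ i) * g i) (λ i → c (n ∸ i) * h i))

⋆-pascal : ∀ k g n → ((_C suc k) ⋆ g) (suc n) ≡ ((_C suc k) ⋆ g) n + ((_C k) ⋆ g) n
⋆-pascal k g n = begin
  Σ≤ (suc n) F              ≡⟨ Σ≤-last n F ⟩
  Σ≤ n F + F (suc n)        ≡⟨ cong (Σ≤ n F +_) last≡0 ⟩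
  Σ≤ n F + 0                ≡⟨ +-identityʳ _ ⟩
  Σ≤ n F                    ≡⟨ Σ≤-cong n pascal ⟩
  Σ≤ n (λ i → G i + H i)    ≡⟨ Σ≤-distrib-+ n G H ⟩
  Σ≤ n G + Σ≤ n H           ∎
  where
  F G H : ℕ → ℕ
  F i = ((suc n ∸ i) C suc k) * g i
  G i = ((n ∸ i) C suc k) * g i
  H i = ((n ∸ i) C k) * g i

  last≡0 : F (suc n) ≡ 0
  last≡0 rewrite n∸n≡0 n = refl

  pascal : ∀ i → i ≤ n → F i ≡ G i + H i
  pascal i i≤n = begin
    ((suc n ∸ i) C suc k) * g i               ≡⟨ cong (λ m → (m C suc k) * g i) (+-∸-assoc 1 i≤n) ⟩
    (suc (n ∸ i) C suc k) * g i               ≡⟨ cong (_* g i) (sym (nCk+nC[k+1]≡[n+1]C[k+1] (n ∸ i) k)) ⟩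
    ((n ∸ i) C k + (n ∸ i) C suc k) * g i     ≡⟨ *-distribʳ-+ (g i) ((n ∸ i) C k) _ ⟩
    H i + G i                                 ≡⟨ +-comm (H i) (G i) ⟩
    G i + H i                                 ∎

⋆-coeff-[] : ∀ c n → (c ⋆ coeff []) n ≡ 0
⋆-coeff-[] c n = Σ≤-zero n _ (λ i → *-zeroʳ (c (n ∸ i)))

⋆-coeff-0∷-zero : ∀ c p → (c ⋆ coeff (0 ∷ p)) 0 ≡ 0
⋆-coeff-0∷-zero c p = cong (_+ 0) (*-zeroʳ (c 0))

⋆-coeff-0∷-suc : ∀ c p n → (c ⋆ coeff (0 ∷ p)) (suc n) ≡ (c ⋆ coeff p) n
⋆-coeff-0∷-suc c p n = cong (_+ (c ⋆ coeff p) n) (*-zeroʳ (c (suc n)))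

⋆-coeff-1∷[] : ∀ c n → (c ⋆ coeff (1 ∷ [])) n ≡ c n
⋆-coeff-1∷[] c zero    = trans (+-identityʳ _) (*-identityʳ _)
⋆-coeff-1∷[] c (suc n) = trans (cong₂ _+_ (*-identityʳ _) (⋆-coeff-[] c n)) (+-identityʳ _)

⋆-mulP-1∷ : ∀ c q p n →
            (c ⋆ coeff (mulP (1 ∷ q) p)) n ≡ (c ⋆ coeff p) n + (c ⋆ coeff (0 ∷ mulP q p)) n
⋆-mulP-1∷ c q p n = trans (⋆-congʳ c n unit) (⋆-distribˡ-+ c (coeff p) (coeff (0 ∷ mulP q p)) n)
  where
  unit : ∀ i → coeff (mulP (1 ∷ q) p) i ≡ coeff p i + coeff (0 ∷ mulP q p) i
  unit i = trans (coeff-mulP-∷ 1 q p i) (cong (_+ coeff (0 ∷ mulP q p) i) (*-identityˡ (coeff p i)))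

windowSum : (ℕ → ℕ) → ℕ → ℕ → ℕ
windowSum Q zero    m       = 0
windowSum Q (suc j) zero    = 0
windowSum Q (suc j) (suc m) = Q m + windowSum Q j m

⋆-mulP-ones : ∀ c t p n → (c ⋆ coeff (mulP (ones t) p)) n ≡ windowSum (c ⋆ coeff p) (suc t) (suc n)
⋆-mulP-ones c zero    p n = begin
  (c ⋆ coeff (mulP (1 ∷ []) p)) n                  ≡⟨ ⋆-mulP-1∷ c [] p n ⟩
  (c ⋆ coeff p) n + (c ⋆ coeff (0 ∷ [])) n         ≡⟨ cong ((c ⋆ coeff p) n +_) (vanishes n) ⟩
  (c ⋆ coeff p) n + 0                              ∎
  where
  vanishes : ∀ n → (c ⋆ coeff (0 ∷ [])) n ≡ 0
  vanishes zero    = ⋆-coeff-0∷-zero c []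
  vanishes (suc n) = trans (⋆-coeff-0∷-suc c [] n) (⋆-coeff-[] c n)

⋆-mulP-ones c (suc t) p n = begin
  (c ⋆ coeff (mulP (1 ∷ ones t) p)) n                   ≡⟨ ⋆-mulP-1∷ c (ones t) p n ⟩
  (c ⋆ coeff p) n + (c ⋆ coeff (0 ∷ mulP (ones t) p)) n ≡⟨ cong ((c ⋆ coeff p) n +_) (shifted n) ⟩
  (c ⋆ coeff p) n + windowSum (c ⋆ coeff p) (suc t) n   ∎
  where
  shifted : ∀ n → (c ⋆ coeff (0 ∷ mulP (ones t) p)) n ≡ windowSum (c ⋆ coeff p) (suc t) n
  shifted zero    = ⋆-coeff-0∷-zero c (mulP (ones t) p)
  shifted (suc n) = trans (⋆-coeff-0∷-suc c (mulP (ones t) p) n) (⋆-mulP-ones c t p n)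

record PathRecurrence (s : ℕ) (P : ℕ → ℕ → ℕ) : Set where
  field
    P[n,0]≡1       : ∀ n → P n 0 ≡ 1
    P[0,1+k]≡0     : ∀ k → P 0 (suc k) ≡ 0
    P[1+n,1+k]≡sum : ∀ n k → P (suc n) (suc k) ≡ P n (suc k) + windowSum (λ m → P m k) s (suc n)

module _ {s : ℕ} {P : ℕ → ℕ → ℕ} (rec : PathRecurrence s P) where
  open PathRecurrence rec

  private
    diagF≡windowSum : ∀ f → (∀ n k → n ≤ f → pathsF f s n k ≡ P n k) →
                      ∀ j m k → m ≤ suc f → diagF f s j m k ≡ windowSum (λ m → P m k) j m
    diagF≡windowSum f ih zero    m       k _         = refl
    diagF≡windowSum f ih (suc j) zero    k _         = refl
    diagF≡windowSum f ih (suc j) (suc m) k (s≤s m≤f) =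
      cong₂ _+_ (ih m k m≤f) (diagF≡windowSum f ih j m k (m≤n⇒m≤1+n m≤f))

  pathsF-unique : ∀ f n k → n ≤ f → pathsF f s n k ≡ P n k
  pathsF-unique f       zero    zero    _         = sym (P[n,0]≡1 0)
  pathsF-unique f       zero    (suc k) _         = sym (P[0,1+k]≡0 k)
  pathsF-unique (suc f) (suc n) zero    (s≤s n≤f) =
    trans (pathsF-unique f n zero n≤f) (trans (P[n,0]≡1 n) (sym (P[n,0]≡1 (suc n))))
  pathsF-unique (suc f) (suc n) (suc k) (s≤s n≤f) = trans
    (cong₂ _+_ (pathsF-unique f n (suc k) n≤f) (diagF≡windowSum f (pathsF-unique f) s (suc n) k (s≤s n≤f)))
    (sym (P[1+n,1+k]≡sum n k))

  paths-unique : ∀ n k → paths s n k ≡ P n k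
  paths-unique n k = pathsF-unique n n k ≤-refl

binom⋆bitnom : ℕ → ℕ → ℕ → ℕ
binom⋆bitnom t n k = ((_C k) ⋆ coeff (powP (ones t) k)) n

binom⋆bitnom-recurrence : ∀ t → PathRecurrence (suc t) (binom⋆bitnom t)
binom⋆bitnom-recurrence t = record
  { P[n,0]≡1       = ⋆-coeff-1∷[] (_C 0)
  ; P[0,1+k]≡0     = λ k → refl
  ; P[1+n,1+k]≡sum = λ n k →
      trans (⋆-pascal k (coeff (powP (ones t) (suc k))) n)
            (cong (binom⋆bitnom t n (suc k) +_) (⋆-mulP-ones (_C k) t (powP (ones t) k) n))
  }

mainTheorem6 : (n k s : ℕ) → 1 Data.Nat.≤ s →
    binomS s n k ≡ sumTo n (λ i → ((n ∸ i) C k) * bitnom (s ∸ 1) k i)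
mainTheorem6 n k (suc t) _ = begin
  binomS (suc t) n k                             ≡⟨ paths-unique (binom⋆bitnom-recurrence t) n k ⟩
  binom⋆bitnom t n k                             ≡⟨ sym (sumTo≡Σ≤ n _) ⟩
  sumTo n (λ i → ((n ∸ i) C k) * bitnom t k i)   ∎
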